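{- Let $A_1=(\mathcal{S}_1,\mathcal{E},\mathcal{I}_1,\mathcal{F}_1,\to_1)$ and $A_2=(\mathcal{S}_2,\mathcal{E},\mathcal{I}_2,\mathcal{F}_2,\to_2)$ be Büchi automata over the same set of events. For $X\subseteq\mathcal{S}_1\times\mathcal{S}_2$ define $$\texttt{fsim}^\texttt{R}_\texttt{delay}(X)\triangleq\mu Y.\ \{(s_1,s_2)\mid s_2\in\mathcal{F}_2\wedge\forall e.\forall s_1\xrightarrow{e}_1 s_1'.\exists s_2\xrightarrow{e}_2 s_2'.\ (s_1',s_2')\in X\}\ \cup\ \{(s_1,s_2)\mid \forall e.\forall s_1\xrightarrow{e}_1 s_1'.\exists s_2\xrightarrow{e}_2 s_2'.\ (s_1',s_2')\in Y\},$$ $$F(X)\triangleq\texttt{fsim}^\texttt{R}_\texttt{delay}(X)\ \cup\ \{(s_1,s_2)\mid s_1\notin\mathcal{F}_1\wedge\forall e.\forall s_1\xrightarrow{e}_1 s_1'.\exists s_2\xrightarrow{e}_2 s_2'.\ (s_1',s_2')\in X\},$$ and for $H\subseteq\mathcal{S}_1\times\mathcal{S}_2$ let $G(H)\triangleq\nu X.\ F(X\cup H)$. Then for every $H\subseteq\mathcal{S}_1\times\mathcal{S}_2$ and every pair $(s_1,s_2)$ with $s_1\in\mathcal{F}_1$: if $(s_1,s_2)\in G(H)$ then $(s_1,s_2)\in\texttt{fsim}^\texttt{R}_\texttt{delay}(H\cup G(H))$.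
   Context: A Büchi automaton $(\mathcal{S},\mathcal{E},\mathcal{I},\mathcal{F},\to)$ consists of a set of states $\mathcal{S}$ (not necessarily finite), a set of events $\mathcal{E}$, initial states $\mathcal{I}\subseteq\mathcal{S}$, accepting states $\mathcal{F}\subseteq\mathcal{S}$, and a labeled transition relation $\to\subseteq\mathcal{S}\times\mathcal{E}\times\mathcal{S}$ (written $s\xrightarrow{e}s'$). $\nu$ and $\mu$ denote greatest and least fixed points of monotone operators on the powerset lattice of $\mathcal{S}_1\times\mathcal{S}_2$. $G(H)$ is the parameterized greatest fixed point of $F$ with parameter $H$. -}

module Defs where

open import Level using (Level; _⊔_) renaming (suc to lsuc; zero to lzero)
open import Data.Product using (Σ; ∃; ∃-syntax; _×_; _,_)
open import Data.Sum using (_⊎_)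
open import Relation.Nullary using (¬_)

record Buchi (E : Set) : Set₁ where
  field
    State   : Set
    Initial : State → Set
    Accept  : State → Set
    _⟶[_]_  : State → E → State → Set

open Buchi public

Rel₁₂ : {E : Set} → Buchi E → Buchi E → (ℓ : Level) → Set (lsuc ℓ)
Rel₁₂ A₁ A₂ ℓ = State A₁ → State A₂ → Set ℓ

_∪ᴿ_ : {E : Set} {A₁ A₂ : Buchi E} {ℓ ℓ' : Level} →
       Rel₁₂ A₁ A₂ ℓ → Rel₁₂ A₁ A₂ ℓ' → Rel₁₂ A₁ A₂ (ℓ ⊔ ℓ')
(X ∪ᴿ Y) s₁ s₂ = X s₁ s₂ ⊎ Y s₁ s₂

Step : {E : Set} (A₁ A₂ : Buchi E) {ℓ : Level} → Rel₁₂ A₁ A₂ ℓ → Rel₁₂ A₁ A₂ ℓ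
Step {E} A₁ A₂ X s₁ s₂ =
  ∀ (e : E) (s₁' : State A₁) → _⟶[_]_ A₁ s₁ e s₁' →
  ∃[ s₂' ] (_⟶[_]_ A₂ s₂ e s₂' × X s₁' s₂')

-- fsim^R_delay(X) = μY. {(s₁,s₂) | s₂ ∈ F₂ ∧ Step X} ∪ {(s₁,s₂) | Step Y}
-- The least fixed point is the inductive family below (initial algebra of
-- the monotone operator).
data FsimDelay {E : Set} (A₁ A₂ : Buchi E) {ℓ : Level} (X : Rel₁₂ A₁ A₂ ℓ)
     : Rel₁₂ A₁ A₂ ℓ where
  base : ∀ {s₁ s₂} → Accept A₂ s₂ → Step A₁ A₂ X s₁ s₂ → FsimDelay A₁ A₂ X s₁ s₂
  later : ∀ {s₁ s₂} →
    (∀ (e : E) (s₁' : State A₁) → _⟶[_]_ A₁ s₁ e s₁' →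
       ∃[ s₂' ] (_⟶[_]_ A₂ s₂ e s₂' × FsimDelay A₁ A₂ X s₁' s₂')) →
    FsimDelay A₁ A₂ X s₁ s₂

Fop : {E : Set} (A₁ A₂ : Buchi E) {ℓ : Level} → Rel₁₂ A₁ A₂ ℓ → Rel₁₂ A₁ A₂ ℓ
Fop A₁ A₂ X s₁ s₂ =
  FsimDelay A₁ A₂ X s₁ s₂ ⊎ ((¬ Accept A₁ s₁) × Step A₁ A₂ X s₁ s₂)

-- G(H) = νX. F(X ∪ H), as the Knaster–Tarski greatest fixed point:
-- the union of all post-fixed points X ⊆ F(X ∪ H) (X ranging over
-- relations at level 0).
G : {E : Set} (A₁ A₂ : Buchi E) → Rel₁₂ A₁ A₂ lzero → Rel₁₂ A₁ A₂ (lsuc lzero)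
G A₁ A₂ H s₁ s₂ =
  Σ (Rel₁₂ A₁ A₂ lzero) λ X →
    (∀ t₁ t₂ → X t₁ t₂ → Fop A₁ A₂ (_∪ᴿ_ {A₁ = A₁} {A₂ = A₂} X H) t₁ t₂) × X s₁ s₂

{-# OPTIONS --safe #-}
module Submission where

open import Defs
open import Level using (Level) renaming (zero to lzero)
open import Data.Product using (_,_)
open import Data.Sum using (inj₁; inj₂; [_,_]′)
open import Data.Empty using (⊥-elim)
open import Function using (_∘_)

-- On an accepting s₁ the second disjunct of F is unavailable, so a pair of
-- G(H) = ν X. F(X ∪ H) with accepting s₁ is delay-simulated into X ∪ H for a
-- post-fixed point X; every such X lies in G(H), and fsim_delay is monotone.

module DelaySimulation {E : Set} (A₁ A₂ : Buchi E) where

  infix 4 _⊆_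
  infixr 6 _∪_

  _⊆_ : {ℓ ℓ' : Level} → Rel₁₂ A₁ A₂ ℓ → Rel₁₂ A₁ A₂ ℓ' → Set _
  X ⊆ Y = ∀ {s₁ s₂} → X s₁ s₂ → Y s₁ s₂

  _∪_ : {ℓ ℓ' : Level} → Rel₁₂ A₁ A₂ ℓ → Rel₁₂ A₁ A₂ ℓ' → Rel₁₂ A₁ A₂ _
  _∪_ = _∪ᴿ_ {A₁ = A₁} {A₂ = A₂}

  Step-mono : {ℓ ℓ' : Level} {X : Rel₁₂ A₁ A₂ ℓ} {Y : Rel₁₂ A₁ A₂ ℓ'} →
              X ⊆ Y → Step A₁ A₂ X ⊆ Step A₁ A₂ Y
  Step-mono X⊆Y step e s₁′ s₁⟶s₁′ =
    let s₂′ , s₂⟶s₂′ , x = step e s₁′ s₁⟶s₁′ in s₂′ , s₂⟶s₂′ , X⊆Y x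

  FsimDelay-mono : {ℓ ℓ' : Level} {X : Rel₁₂ A₁ A₂ ℓ} {Y : Rel₁₂ A₁ A₂ ℓ'} →
                   X ⊆ Y → FsimDelay A₁ A₂ X ⊆ FsimDelay A₁ A₂ Y
  FsimDelay-mono X⊆Y (base acc step) = base acc (Step-mono X⊆Y step)
  -- Step-mono (FsimDelay-mono X⊆Y) would not pass the termination checker.
  FsimDelay-mono X⊆Y (later step)    = later λ e s₁′ s₁⟶s₁′ →
    let s₂′ , s₂⟶s₂′ , sim = step e s₁′ s₁⟶s₁′ in s₂′ , s₂⟶s₂′ , FsimDelay-mono X⊆Y sim

  Fop-accepting : {ℓ : Level} {X : Rel₁₂ A₁ A₂ ℓ} {s₁ : State A₁} {s₂ : State A₂} →
                  Accept A₁ s₁ → Fop A₁ A₂ X s₁ s₂ → FsimDelay A₁ A₂ X s₁ s₂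
  Fop-accepting acc (inj₁ sim)        = sim
  Fop-accepting acc (inj₂ (¬acc , _)) = ⊥-elim (¬acc acc)

  G-coinduction : {H X : Rel₁₂ A₁ A₂ lzero} →
                  X ⊆ Fop A₁ A₂ (X ∪ H) → X ⊆ G A₁ A₂ H
  G-coinduction {X = X} post x = X , (λ _ _ → post) , x

lemma4p7 : {E : Set} (A₁ A₂ : Buchi E) (H : Rel₁₂ A₁ A₂ lzero) →
           (s₁ : State A₁) (s₂ : State A₂) → Accept A₁ s₁ →
           G A₁ A₂ H s₁ s₂ → FsimDelay A₁ A₂ (_∪ᴿ_ {A₁ = A₁} {A₂ = A₂} H (G A₁ A₂ H)) s₁ s₂
lemma4p7 A₁ A₂ H s₁ s₂ acc (X , post , x) =
  FsimDelay-mono X∪H⊆H∪GH (Fop-accepting acc (post s₁ s₂ x))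
  where
  open DelaySimulation A₁ A₂

  X∪H⊆H∪GH : X ∪ H ⊆ H ∪ G A₁ A₂ H
  X∪H⊆H∪GH = [ inj₂ ∘ G-coinduction (λ {t₁ t₂} → post t₁ t₂) , inj₁ ]′
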